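{- Let $M$ be a partial multiplication matrix, and let $\pi^\#$ be a non-singleton $M$-indivisible $M$-gridded permutation. Then there is a cycle $C$ of $G_M$ such that every cell of $\pi^\#$ corresponding to an edge of $C$ is non-empty and the gridded subpermutation of $\pi^\#$ consisting of the last point of each of these cells is $M$-indivisible.
   Context: A gridding matrix is a matrix with entries in $\{0,1,-1\}$ ($m$ columns, $n$ rows; $M_{ij}$ in column $i$ from the left, row $j$ from the bottom). An $M$-gridding of a permutation is a division of its plot by $m-1$ vertical and $n-1$ horizontal lines into cells, each point interior to a cell, with cell $ij$ empty if $M_{ij}=0$, increasing if $M_{ij}=1$, decreasing if $M_{ij}=-1$; an $M$-gridded permutation is a permutation with a fixed $M$-gridding, and its gridded subpermutations inherit the gridding. The row-column graph $G_M$ is the bipartite graph on columns $1,\dots,m$ and rows $1',\dots,n'$ with edge $ij'$ iff $M_{ij}\neq0$; cell $ij$ corresponds to edge $ij'$. A partial multiplication matrix is a gridding matrix with fixed $c_i,r_j\in\{\pm1\}$ such that $M_{ij}=c_ir_j$ whenever $M_{ij}\ne0$; column $i$ is oriented left-to-right if $c_i=1$ and right-to-left otherwise, row $j$ bottom-to-top if $r_j=1$ and top-to-bottom otherwise. The orientation digraph $D_{\pi^\#}$ has an arc $x\to y$ between points sharing a column (resp. row) when $x$ precedes $y$ in its orientation; the points of a cell are totally ordered this way and the last point of a cell is the final one. The $M$-sum $\sigma^\#\boxplus\tau^\#$ is the $M$-gridded permutation whose cell $ij$ contains the points of cell $ij$ of both $\sigma^\#,\tau^\#$, each keeping their relative positions,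 with each point of $\sigma^\#$ preceding each point of $\tau^\#$ in the orientation of every column and row; a gridded permutation is $M$-indivisible if it is not an $M$-sum of two nonempty gridded permutations. -}

module Defs where

open import Data.Nat using (ℕ; suc; _<_)
open import Data.Fin using (Fin; zero; suc; inject₁; fromℕ) renaming (_≤_ to _≤ᶠ_)
open import Data.Sign using (Sign) renaming (_*_ to _*ˢ_)
open import Data.Bool using (Bool; true; false)
open import Data.Product using (Σ; _×_; ∃)
open import Data.Unit using (⊤)
open import Relation.Nullary using (¬_)
open import Relation.Binary.PropositionalEquality using (_≡_; _≢_)
open import Function.Definitions using (Injective)

data Entry : Set where
  zeroE : Entry
  incE  : Entry
  decE  : Entry

signEntry : Sign → Entry
signEntry Sign.+ = incE
signEntry Sign.- = decE

-- Partial multiplication matrix with m columns and n rows.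
-- M i j : entry in column i, row j.  c i / r j : column / row signs.

record PMM (m n : ℕ) : Set where
  field
    M : Fin m → Fin n → Entry
    c : Fin m → Sign
    r : Fin n → Sign
    consistent : ∀ i j → M i j ≢ zeroE → M i j ≡ signEntry (c i *ˢ r j)
open PMM public

-- shape of a cell: increasing / decreasing (the zero case is excluded separately)
Mono : Entry → ℕ → ℕ → Set
Mono zeroE _ _ = ⊤
Mono incE  a b = a < b
Mono decE  a b = b < a

-- Points are Fin size; a point has a horizontal
-- and a vertical coordinate (only their relative order matters, as for
-- the plot of a permutation) and a cell (column, row).

record GPerm {m n : ℕ} (P : PMM m n) : Set where
  field
    size : ℕ
    xpos : Fin size → ℕ
    ypos : Fin size → ℕ
    col  : Fin size → Fin m
    row  : Fin size → Fin n
    xinj : Injective _≡_ _≡_ xpos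
    yinj : Injective _≡_ _≡_ ypos
    -- grid lines exist: columns increase left to right, rows bottom to top
    colMono : ∀ p q → xpos p < xpos q → col p ≤ᶠ col q
    rowMono : ∀ p q → ypos p < ypos q → row p ≤ᶠ row q
    nonzero : ∀ p → M P (col p) (row p) ≢ zeroE
    shape : ∀ p q → col p ≡ col q → row p ≡ row q → xpos p < xpos q →
            Mono (M P (col p) (row p)) (ypos p) (ypos q)
open GPerm public

module _ {m n : ℕ} {P : PMM m n} (π : GPerm P) where

  ColBefore : Fin (size π) → Fin (size π) → Set
  ColBefore x y with c P (col π x)
  ... | Sign.+ = xpos π x < xpos π y
  ... | Sign.- = xpos π y < xpos π x

  RowBefore : Fin (size π) → Fin (size π) → Set
  RowBefore x y with r P (row π x)
  ... | Sign.+ = ypos π x < ypos π y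
  ... | Sign.- = ypos π y < ypos π x

  Precedes : Fin (size π) → Fin (size π) → Set
  Precedes x y = (col π x ≡ col π y → ColBefore x y)
               × (row π x ≡ row π y → RowBefore x y)

  -- The gridded subpermutation on the point set A is an M-sum of two
  -- nonempty gridded permutations: A splits into nonempty parts
  -- S (s = true) and T (s = false) with every point of S preceding
  -- every point of T in each column and row.
  Divisible : (Fin (size π) → Set) → Set
  Divisible A = Σ (Fin (size π) → Bool) λ s →
      (∃ λ x → A x × s x ≡ true)
    × (∃ λ y → A y × s y ≡ false)
    × (∀ x y → A x → A y → s x ≡ true → s y ≡ false → Precedes x y)

  Indivisible : (Fin (size π) → Set) → Set
  Indivisible A = ¬ Divisible A

  AllPoints : Fin (size π) → Set
  AllPoints _ = ⊤

  MIndivisible : Set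
  MIndivisible = Indivisible AllPoints

  CellNonempty : Fin m → Fin n → Set
  CellNonempty i j = ∃ λ x → col π x ≡ i × row π x ≡ j

  IsLast : Fin (size π) → Set
  IsLast x = ∀ y → col π y ≡ col π x → row π y ≡ row π x → y ≢ x → ColBefore y x

-- Cycles of the row-column graph G_M.
-- A cycle  i₀ j₀' i₁ j₁' … i_k j_k' i₀  (k+1 ≥ 2 distinct columns and
-- k+1 distinct rows), each consecutive pair adjacent in G_M.

record Cycle {m n : ℕ} (P : PMM m n) : Set where
  field
    len  : ℕ                       -- number of columns is suc (suc len)
    cols : Fin (suc (suc len)) → Fin m
    rows : Fin (suc (suc len)) → Fin n
    colsInj : Injective _≡_ _≡_ cols
    rowsInj : Injective _≡_ _≡_ rows
open Cycle public

-- Cell (i , j) corresponds to an edge i j' of the cycle C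
data InCycle {m n : ℕ} {P : PMM m n} (C : Cycle P) : Fin m → Fin n → Set where
  diag  : ∀ t → InCycle C (cols C t) (rows C t)
  step  : ∀ (t : Fin (suc (len C))) → InCycle C (cols C (suc t)) (rows C (inject₁ t))
  close : InCycle C (cols C zero) (rows C (fromℕ (suc (len C))))

IsCycleOf : {m n : ℕ} {P : PMM m n} → Cycle P → Set
IsCycleOf {P = P} C = ∀ i j → InCycle C i j → M P i j ≢ zeroE

LastPoints : {m n : ℕ} {P : PMM m n} (π : GPerm P) → Cycle P → Fin (size π) → Set
LastPoints π C x = InCycle C (col π x) (row π x) × IsLast π x

{-# OPTIONS --safe #-}
-- Let next x be the last point in the column of the last point in the row of x. Values of
-- next are last in their columns, and a fixed point of next would also be last in its row,
-- so it could be split off π. Hence, by pigeonhole, next has a cycle u₀ … u_l with l ≥ 1 of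
-- distinct points. Let vₜ be the last point in the row of uₜ, so that uₜ₊₁ is the last point
-- in the column of vₜ. Distinct column-last points lie in distinct columns, and equal rows
-- of uₛ, uₜ would give vₛ = vₜ and uₛ₊₁ = uₜ₊₁; so the columns and rows of the uₜ form a
-- cycle of G_M, and the last points of its cells are exactly the uₜ and vₜ. The last point
-- of a line precedes no other point of it, so the second part of a split of these points is
-- closed under uₜ ↦ vₜ ↦ uₜ₊₁ and would contain all of them.
module Submission where

open import Defs
open import Level using (0ℓ)
open import Data.Nat using (ℕ; zero; suc; _≤_; _<_; _+_; _∸_; s≤s; s≤s⁻¹)
open import Data.Nat.Properties
  using (≤-isTotalOrder; ≤∧≢⇒<; <-irrefl; <-asym; <-cmp; <⇒≤; ≤-trans; m≤m+n; +-monoʳ-<;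
         m∸n+n≡m; m<n⇒0<n∸m; n<1+n)
open import Data.Fin using (Fin; Fin′; toℕ; fromℕ; fromℕ<; inject; inject₁; punchIn; _≟_)
  renaming (zero to fzero; suc to fsuc)
open import Data.Fin.Properties
  using (toℕ-injective; toℕ<n; toℕ-fromℕ; toℕ-fromℕ<; toℕ-inject; toℕ-inject₁;
         suc-injective; ≤fromℕ; pigeonhole; punchInᵢ≢i; ¬∀⟶∃¬-smallest)
open import Data.Fin.Induction using (<-weakInduction; <-weakInduction-startingFrom)
open import Data.Fin.Relation.Unary.Top using (view; ‵fromℕ; ‵inject₁)
open import Data.Sign using (Sign) renaming (_*_ to _*ˢ_)
open import Data.Bool using (Bool; true; false; not)
open import Data.Product using (Σ; _×_; _,_; proj₂; ∃; ∃₂)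
open import Data.Unit using (⊤; tt)
open import Data.List using (List; filter; allFin)
open import Data.List.Membership.Propositional.Properties using (∈-allFin; ∈-filter⁺)
open import Data.List.Relation.Unary.All using (lookup)
open import Data.List.Relation.Unary.All.Properties using (all-filter)
import Data.List.Extrema as Extrema
open import Function using (_∘_; id; _⇔_; mk⇔; Equivalence)
open import Function.Definitions using (Injective)
import Function.Endo.Propositional as Endo
open import Relation.Binary
  using (TotalOrder; IsTotalOrder; DecidableEquality; tri<; tri≈; tri>)
import Relation.Binary.Construct.Flip.EqAndOrd as Flip
open import Relation.Nullary using (¬_; yes; no; contradiction; ¬?)
open import Relation.Nullary.Decidable using (does; decidable-stable; dec-true; dec-false)
open import Relation.Binary.PropositionalEquality

open Equivalence using (to; from)

infix 4 _<[_]_ _≤[_]_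

_<[_]_ : ℕ → Sign → ℕ → Set
a <[ Sign.+ ] b = a < b
a <[ Sign.- ] b = b < a

<[]-irrefl : ∀ s {a} → ¬ a <[ s ] a
<[]-irrefl Sign.+ = <-irrefl refl
<[]-irrefl Sign.- = <-irrefl refl

<[]-asym : ∀ s {a b} → a <[ s ] b → ¬ b <[ s ] a
<[]-asym Sign.+ = <-asym
<[]-asym Sign.- = <-asym

_≤[_]_ : ℕ → Sign → ℕ → Set
a ≤[ Sign.+ ] b = a ≤ b
a ≤[ Sign.- ] b = b ≤ a

≤[]-isTotalOrder : ∀ s → IsTotalOrder _≡_ (_≤[ s ]_)
≤[]-isTotalOrder Sign.+ = ≤-isTotalOrder
≤[]-isTotalOrder Sign.- = Flip.isTotalOrder ≤-isTotalOrder

orientedOrder : Sign → TotalOrder 0ℓ 0ℓ 0ℓ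
orientedOrder s = record { isTotalOrder = ≤[]-isTotalOrder s }

≤∧≢⇒<[] : ∀ s {a b} → a ≤[ s ] b → a ≢ b → a <[ s ] b
≤∧≢⇒<[] Sign.+ a≤b a≢b = ≤∧≢⇒< a≤b a≢b
≤∧≢⇒<[] Sign.- b≤a a≢b = ≤∧≢⇒< b≤a (a≢b ∘ sym)

mono-*ˢ⇒+ : ∀ s t {a b} → Mono (signEntry (s *ˢ t)) a b → a <[ t ] b → s ≡ Sign.+
mono-*ˢ⇒+ Sign.+ _      _   _   = refl
mono-*ˢ⇒+ Sign.- Sign.+ b<a a<b = contradiction a<b (<-asym b<a)
mono-*ˢ⇒+ Sign.- Sign.- a<b b<a = contradiction a<b (<-asym b<a)

mono-*ˢ⇒- : ∀ s t {a b} → Mono (signEntry (s *ˢ t)) b a → a <[ t ] b → s ≡ Sign.-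
mono-*ˢ⇒- Sign.+ Sign.+ b<a a<b = contradiction a<b (<-asym b<a)
mono-*ˢ⇒- Sign.+ Sign.- a<b b<a = contradiction a<b (<-asym b<a)
mono-*ˢ⇒- Sign.- _      _   _   = refl

module OrientedLines {N : ℕ} {L : Set} (_≟ᴸ_ : DecidableEquality L)
  (pos : Fin N → ℕ) (pos-injective : Injective _≡_ _≡_ pos)
  (line : Fin N → L) (orientation : L → Sign) where

  Before : Fin N → Fin N → Set
  Before x y = pos x <[ orientation (line x) ] pos y

  IsLastOnLine : Fin N → Set
  IsLastOnLine x = ∀ y → line y ≡ line x → y ≢ x → Before y x

  Before-asym : ∀ {x y} → line x ≡ line y → Before x y → ¬ Before y x
  Before-asym {x} {y} same x<y =
    <[]-asym (orientation (line y)) (subst (λ l → pos x <[ orientation l ] pos y) same x<y)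

  lastOnLine-notBefore : ∀ {z w} → IsLastOnLine z → line w ≡ line z → ¬ Before z w
  lastOnLine-notBefore {z} {w} z-last same z<w with w ≟ z
  ... | yes refl = <[]-irrefl (orientation (line z)) z<w
  ... | no w≢z   = Before-asym same (z-last w same w≢z) z<w

  lastOnLine-unique : ∀ {a b} → IsLastOnLine a → IsLastOnLine b → line a ≡ line b → a ≡ b
  lastOnLine-unique {a} {b} a-last b-last same = decidable-stable (a ≟ b) λ a≢b →
    lastOnLine-notBefore b-last same (a-last b (sym same) (a≢b ∘ sym))

  private
    onLineOf : Fin N → List (Fin N)
    onLineOf x = filter (λ y → line y ≟ᴸ line x) (allFin N)

  lastOnLine : Fin N → Fin N
  lastOnLine x = argmax pos x (onLineOf x)
    where open Extrema (orientedOrder (orientation (line x)))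

  line-lastOnLine : ∀ x → line (lastOnLine x) ≡ line x
  line-lastOnLine x = argmax-all pos {P = λ y → line y ≡ line x} refl (all-filter _ (allFin N))
    where open Extrema (orientedOrder (orientation (line x)))

  lastOnLine-isLast : ∀ x → IsLastOnLine (lastOnLine x)
  lastOnLine-isLast x y same y≢z =
    subst (λ l → pos y <[ orientation l ] pos (lastOnLine x)) (sym y-on-x)
      (≤∧≢⇒<[] (orientation (line x)) y≤z (y≢z ∘ pos-injective))
    where
    open Extrema (orientedOrder (orientation (line x)))
    y-on-x : line y ≡ line x
    y-on-x = trans same (line-lastOnLine x)
    y≤z : pos y ≤[ orientation (line x) ] pos (lastOnLine x)
    y≤z = lookup (f[xs]≤f[argmax] x (onLineOf x)) (∈-filter⁺ _ (∈-allFin y) y-on-x)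

  lastOnLine-cong : ∀ {x y} → line x ≡ line y → lastOnLine x ≡ lastOnLine y
  lastOnLine-cong {x} {y} same = lastOnLine-unique (lastOnLine-isLast x) (lastOnLine-isLast y)
    (trans (line-lastOnLine x) (trans same (sym (line-lastOnLine y))))

module _ {A : Set} (f : A → A) where
  open Endo A using (_^_; ^-homo)

  record IsMinimalPeriod (q : A) (p : ℕ) : Set where
    field
      periodic : (f ^ p) q ≡ q
      minimal  : ∀ {k} → 0 < k → k < p → (f ^ k) q ≢ q

  minimalPeriod : DecidableEquality A → ∀ {q p} → 0 < p → (f ^ p) q ≡ q →
                  ∃ λ d → IsMinimalPeriod q (suc d)
  minimalPeriod _≟ᴬ_ {q} {suc p} _ periodic =
    firstReturn (¬∀⟶∃¬-smallest (suc p) NotReturned (λ e → ¬? (_ ≟ᴬ q)) neverReturns)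
    where
    NotReturned : Fin (suc p) → Set
    NotReturned e = (f ^ suc (toℕ e)) q ≢ q
    neverReturns : ¬ (∀ e → NotReturned e)
    neverReturns never =
      never (fromℕ p) (subst (λ k → (f ^ suc k) q ≡ q) (sym (toℕ-fromℕ p)) periodic)
    firstReturn : (∃ λ i → ¬ NotReturned i × ((j : Fin′ i) → NotReturned (inject j))) →
                  ∃ λ d → IsMinimalPeriod q (suc d)
    firstReturn (i , returns , earlier) =
      toℕ i , record { periodic = decidable-stable (_ ≟ᴬ q) returns ; minimal = minimal }
      where
      minimal : ∀ {k} → 0 < k → k < suc (toℕ i) → (f ^ k) q ≢ q
      minimal {suc e} _ k<i =
        subst (λ k → (f ^ suc k) q ≢ q) index (earlier (fromℕ< (s≤s⁻¹ k<i)))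
        where
        index : toℕ (inject (fromℕ< (s≤s⁻¹ k<i))) ≡ e
        index = trans (toℕ-inject _) (toℕ-fromℕ< _)

  -- Running on from the later of two equal iterates returns to q before time p.
  minimalPeriod-distinct : ∀ {q p} → IsMinimalPeriod q p →
                           ∀ {s t} → s < t → t < p → (f ^ s) q ≢ (f ^ t) q
  minimalPeriod-distinct {q} {p} mp {s} {t} s<t t<p same = minimal positive shorter (begin
    (f ^ (p ∸ t + s)) q        ≡⟨ cong-app (^-homo f (p ∸ t) s) q ⟩
    (f ^ (p ∸ t)) ((f ^ s) q)  ≡⟨ cong (f ^ (p ∸ t)) same ⟩
    (f ^ (p ∸ t)) ((f ^ t) q)  ≡⟨ cong-app (^-homo f (p ∸ t) t) q ⟨
    (f ^ (p ∸ t + t)) q        ≡⟨ cong (λ k → (f ^ k) q) (m∸n+n≡m (<⇒≤ t<p)) ⟩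
    (f ^ p) q                  ≡⟨ periodic ⟩
    q                          ∎)
    where
    open IsMinimalPeriod mp
    open ≡-Reasoning
    positive : 0 < p ∸ t + s
    positive = ≤-trans (m<n⇒0<n∸m t<p) (m≤m+n (p ∸ t) s)
    shorter : p ∸ t + s < p
    shorter = subst (p ∸ t + s <_) (m∸n+n≡m (<⇒≤ t<p)) (+-monoʳ-< (p ∸ t) s<t)

  minimalPeriod-injective : ∀ {q p} → IsMinimalPeriod q p →
                            ∀ {s t} → s < p → t < p → (f ^ s) q ≡ (f ^ t) q → s ≡ t
  minimalPeriod-injective mp {s} {t} s<p t<p same with <-cmp s t
  ... | tri< s<t _ _ = contradiction same (minimalPeriod-distinct mp s<t t<p)
  ... | tri≈ _ s≡t _ = s≡t
  ... | tri> _ _ t<s = contradiction (sym same) (minimalPeriod-distinct mp t<s s<p)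

  record CyclicOrbit (d : ℕ) : Set where
    field
      point      : Fin (suc d) → A
      injective  : Injective _≡_ _≡_ point
      point-suc  : ∀ t → point (fsuc t) ≡ f (point (inject₁ t))
      point-zero : point fzero ≡ f (point (fromℕ d))

    point-image : ∀ t → ∃ λ t′ → point t ≡ f (point t′)
    point-image fzero    = fromℕ d , point-zero
    point-image (fsuc t) = inject₁ t , point-suc t

    f∘point-injective : Injective _≡_ _≡_ (f ∘ point)
    f∘point-injective {s} {t} same with view s | view t
    ... | ‵fromℕ     | ‵fromℕ     = refl
    ... | ‵fromℕ     | ‵inject₁ j =
      contradiction (injective (trans point-zero (trans same (sym (point-suc j))))) λ ()
    ... | ‵inject₁ i | ‵fromℕ     =
      contradiction (injective (trans (point-suc i) (trans same (sym point-zero)))) λ ()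
    ... | ‵inject₁ i | ‵inject₁ j =
      cong inject₁ (suc-injective (injective (trans (point-suc i) (trans same (sym (point-suc j))))))

  minimalPeriod⇒cyclicOrbit : ∀ {q d} → IsMinimalPeriod q (suc d) → CyclicOrbit d
  minimalPeriod⇒cyclicOrbit {q} {d} mp = record
    { point      = λ t → (f ^ toℕ t) q
    ; injective  = λ same → toℕ-injective (minimalPeriod-injective mp (toℕ<n _) (toℕ<n _) same)
    ; point-suc  = λ t → cong (λ k → f ((f ^ k) q)) (sym (toℕ-inject₁ t))
    ; point-zero = trans (sym periodic) (cong (λ k → f ((f ^ k) q)) (sym (toℕ-fromℕ d)))
    }
    where open IsMinimalPeriod mp

module _ {N : ℕ} (f : Fin N → Fin N) where
  open Endo (Fin N) using (_^_; ^-homo)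

  periodicPoint : Fin N → ∃₂ λ q p → 0 < p × (f ^ p) q ≡ q
  periodicPoint x with i , j , i<j , same ← pigeonhole (n<1+n N) (λ i → (f ^ toℕ i) x) =
    (f ^ toℕ i) x , toℕ j ∸ toℕ i , m<n⇒0<n∸m i<j , (begin
      (f ^ (toℕ j ∸ toℕ i)) ((f ^ toℕ i) x)  ≡⟨ cong-app (^-homo f (toℕ j ∸ toℕ i) (toℕ i)) x ⟨
      (f ^ (toℕ j ∸ toℕ i + toℕ i)) x        ≡⟨ cong (λ k → (f ^ k) x) (m∸n+n≡m (<⇒≤ i<j)) ⟩
      (f ^ toℕ j) x                          ≡⟨ same ⟨
      (f ^ toℕ i) x                          ∎)
    where open ≡-Reasoning

  cyclicOrbit : Fin N → ∃ λ d → CyclicOrbit f d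
  cyclicOrbit x with periodicPoint x
  ... | _ , _ , positive , periodic with minimalPeriod f _≟_ positive periodic
  ...   | d , mp = d , minimalPeriod⇒cyclicOrbit f mp

cyclic-induction : ∀ {d} (Q : Fin (suc d) → Set) →
                   (∀ j → Q (inject₁ j) → Q (fsuc j)) → (Q (fromℕ d) → Q fzero) →
                   ∀ {i} → Q i → ∀ j → Q j
cyclic-induction Q Q-suc Q-wrap {i} Qi =
  <-weakInduction Q (Q-wrap (<-weakInduction-startingFrom Q Qi Q-suc (≤fromℕ i))) Q-suc

anotherPoint : ∀ {N} → 2 ≤ N → (x : Fin N) → ∃ λ y → y ≢ x
anotherPoint (s≤s (s≤s _)) x = punchIn x fzero , punchInᵢ≢i x fzero

module _ {m n : ℕ} {P : PMM m n} (π : GPerm P) where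

  private
    Point : Set
    Point = Fin (size π)

  module Columns = OrientedLines _≟_ (xpos π) (xinj π) (col π) (c P)
  module Rows    = OrientedLines _≟_ (ypos π) (yinj π) (row π) (r P)

  colBefore⇔ : ∀ x y → ColBefore π x y ⇔ Columns.Before x y
  colBefore⇔ x y with c P (col π x)
  ... | Sign.+ = mk⇔ id id
  ... | Sign.- = mk⇔ id id

  rowBefore⇔ : ∀ x y → RowBefore π x y ⇔ Rows.Before x y
  rowBefore⇔ x y with r P (row π x)
  ... | Sign.+ = mk⇔ id id
  ... | Sign.- = mk⇔ id id

  cellNonempty⇒nonzero : ∀ {i j} → CellNonempty π i j → M P i j ≢ zeroE
  cellNonempty⇒nonzero (x , refl , refl) = nonzero π x

  cell-mono : ∀ {x y i j} → col π x ≡ i → col π y ≡ i → row π x ≡ j → row π y ≡ j →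
              xpos π x < xpos π y → Mono (signEntry (c P i *ˢ r P j)) (ypos π x) (ypos π y)
  cell-mono {x} refl y-col refl y-row left = subst (λ e → Mono e _ _)
    (consistent P _ _ (nonzero π x)) (shape π x _ (sym y-col) (sym y-row) left)

  -- Within a cell the entry is c i * r j, so the shape of the cell makes the row
  -- orientation agree with the column orientation.
  rowBefore⇒colBefore : ∀ {x y} → col π x ≡ col π y → row π x ≡ row π y → x ≢ y →
                        Rows.Before x y → Columns.Before x y
  rowBefore⇒colBefore {x} {y} same-col same-row x≢y x<y with <-cmp (xpos π x) (xpos π y)
  ... | tri< left _ _ = subst (λ s → xpos π x <[ s ] xpos π y) (sym forward) left
    where
    forward : c P (col π x) ≡ Sign.+
    forward = mono-*ˢ⇒+ _ _ (cell-mono refl (sym same-col) refl (sym same-row) left) x<y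
  ... | tri≈ _ same-x _ = contradiction (xinj π same-x) x≢y
  ... | tri> _ _ right = subst (λ s → xpos π x <[ s ] xpos π y) (sym backward) right
    where
    backward : c P (col π x) ≡ Sign.-
    backward = mono-*ˢ⇒- _ _ (cell-mono (sym same-col) refl (sym same-row) refl right) x<y

  colLast⇒isLast : ∀ {x} → Columns.IsLastOnLine x → IsLast π x
  colLast⇒isLast {x} x-last y same-col _ y≢x = from (colBefore⇔ y x) (x-last y same-col y≢x)

  rowLast⇒isLast : ∀ {x} → Rows.IsLastOnLine x → IsLast π x
  rowLast⇒isLast {x} x-last y same-col same-row y≢x =
    from (colBefore⇔ y x) (rowBefore⇒colBefore same-col same-row y≢x (x-last y same-row y≢x))

  isLast-unique : ∀ {a b} → IsLast π a → IsLast π b →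
                  col π a ≡ col π b → row π a ≡ row π b → a ≡ b
  isLast-unique {a} {b} a-last b-last same-col same-row = decidable-stable (a ≟ b) λ a≢b →
    Columns.Before-asym same-col
      (to (colBefore⇔ a b) (b-last a same-col same-row a≢b))
      (to (colBefore⇔ b a) (a-last b (sym same-col) (sym same-row) (a≢b ∘ sym)))

  lastOnColumn-notPrecedes : ∀ {z w} → Columns.IsLastOnLine z → col π w ≡ col π z →
                             ¬ Precedes π z w
  lastOnColumn-notPrecedes z-last same (z<w , _) =
    Columns.lastOnLine-notBefore z-last same (to (colBefore⇔ _ _) (z<w (sym same)))

  lastOnRow-notPrecedes : ∀ {z w} → Rows.IsLastOnLine z → row π w ≡ row π z →
                          ¬ Precedes π z w
  lastOnRow-notPrecedes z-last same (_ , z<w) =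
    Rows.lastOnLine-notBefore z-last same (to (rowBefore⇔ _ _) (z<w (sym same)))

  split-false-closed : ∀ {A : Point → Set} {s : Point → Bool} →
    (∀ x y → A x → A y → s x ≡ true → s y ≡ false → Precedes π x y) →
    ∀ {z w} → A z → A w → ¬ Precedes π z w → s w ≡ false → s z ≡ false
  split-false-closed {s = s} precedes {z} {w} Az Aw z⊀w sw with s z in sz
  ... | false = refl
  ... | true  = contradiction (precedes z w Az Aw sz sw) z⊀w

  lastPoint-splitsOff : ∀ {x y} → (∀ z → z ≢ x → Precedes π z x) → y ≢ x →
                        Divisible π (AllPoints π)
  lastPoint-splitsOff {x} {y} precedes-x y≢x =
    isOther , (y , tt , cong not (dec-false (y ≟ x) y≢x))
            , (x , tt , cong not (dec-true (x ≟ x) refl)) , precedes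
    where
    isOther : Point → Bool
    isOther z = not (does (z ≟ x))
    precedes : ∀ a b → ⊤ → ⊤ → isOther a ≡ true → isOther b ≡ false → Precedes π a b
    precedes a b _ _ a-other b-not with a ≟ x | b ≟ x
    precedes a b _ _ ()      b-not | yes _  | _
    precedes a b _ _ a-other ()    | no _   | no _
    precedes a b _ _ a-other b-not | no a≢x | yes refl = precedes-x a a≢x

  next : Point → Point
  next x = Columns.lastOnLine (Rows.lastOnLine x)

  fixedPoint⇒divisible : ∀ {x} → next x ≡ x → 2 ≤ size π → Divisible π (AllPoints π)
  fixedPoint⇒divisible {x} fixed two =
    lastPoint-splitsOff precedes-x (proj₂ (anotherPoint two x))
    where
    x-colLast : Columns.IsLastOnLine x
    x-colLast = subst Columns.IsLastOnLine fixed (Columns.lastOnLine-isLast _)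
    rowLast≡x : Rows.lastOnLine x ≡ x
    rowLast≡x = isLast-unique (rowLast⇒isLast (Rows.lastOnLine-isLast x)) (colLast⇒isLast x-colLast)
      (trans (sym (Columns.line-lastOnLine _)) (cong (col π) fixed)) (Rows.line-lastOnLine x)
    x-rowLast : Rows.IsLastOnLine x
    x-rowLast = subst Rows.IsLastOnLine rowLast≡x (Rows.lastOnLine-isLast x)
    precedes-x : ∀ z → z ≢ x → Precedes π z x
    precedes-x z z≢x = (λ same → from (colBefore⇔ z x) (x-colLast z same z≢x))
                     , (λ same → from (rowBefore⇔ z x) (x-rowLast z same z≢x))

  module OrbitCycle {l : ℕ} (O : CyclicOrbit next (suc l)) where
    open CyclicOrbit O renaming (point to u)

    v : Fin (suc (suc l)) → Point
    v t = Rows.lastOnLine (u t)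

    u-colLast : ∀ t → Columns.IsLastOnLine (u t)
    u-colLast t with t′ , u≡ ← point-image t =
      subst Columns.IsLastOnLine (sym u≡) (Columns.lastOnLine-isLast (v t′))

    v-rowLast : ∀ t → Rows.IsLastOnLine (v t)
    v-rowLast t = Rows.lastOnLine-isLast (u t)

    col-v : ∀ {t t′} → u t′ ≡ next (u t) → col π (v t) ≡ col π (u t′)
    col-v {t} u≡ = trans (sym (Columns.line-lastOnLine (v t))) (cong (col π) (sym u≡))

    row-v : ∀ t → row π (v t) ≡ row π (u t)
    row-v t = Rows.line-lastOnLine (u t)

    cycle : Cycle P
    cycle = record
      { len     = l
      ; cols    = col π ∘ u
      ; rows    = row π ∘ u
      ; colsInj = λ same → injective (Columns.lastOnLine-unique (u-colLast _) (u-colLast _) same)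
      ; rowsInj = λ same → f∘point-injective (cong Columns.lastOnLine (Rows.lastOnLine-cong same))
      }

    v-inCycle : ∀ t → InCycle cycle (col π (v t)) (row π (v t))
    v-inCycle t with view t
    ... | ‵fromℕ     = subst₂ (InCycle cycle) (sym (col-v point-zero)) (sym (row-v t)) close
    ... | ‵inject₁ j = subst₂ (InCycle cycle) (sym (col-v (point-suc j))) (sym (row-v t)) (step j)

    u∈lastPoints : ∀ t → LastPoints π cycle (u t)
    u∈lastPoints t = diag t , colLast⇒isLast (u-colLast t)

    v∈lastPoints : ∀ t → LastPoints π cycle (v t)
    v∈lastPoints t = v-inCycle t , rowLast⇒isLast (v-rowLast t)

    data CyclePoint : Point → Set where
      u-point : ∀ t → CyclePoint (u t)
      v-point : ∀ {t t′} → u t′ ≡ next (u t) → CyclePoint (v t)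

    cyclePoint-isLast : ∀ {w} → CyclePoint w → IsLast π w
    cyclePoint-isLast (u-point t)         = colLast⇒isLast (u-colLast t)
    cyclePoint-isLast (v-point {t = t} _) = rowLast⇒isLast (v-rowLast t)

    cell-cyclePoint : ∀ {i j} → InCycle cycle i j →
                      Σ Point λ w → col π w ≡ i × row π w ≡ j × CyclePoint w
    cell-cyclePoint (diag t) = u t , refl , refl , u-point t
    cell-cyclePoint (step t) =
      v (inject₁ t) , col-v (point-suc t) , row-v (inject₁ t) , v-point (point-suc t)
    cell-cyclePoint close    =
      v (fromℕ _) , col-v point-zero , row-v (fromℕ _) , v-point point-zero

    cycle-cellsNonempty : ∀ i j → InCycle cycle i j → CellNonempty π i j
    cycle-cellsNonempty i j ic with w , same-col , same-row , _ ← cell-cyclePoint ic =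
      w , same-col , same-row

    cycle-isCycleOf : IsCycleOf cycle
    cycle-isCycleOf i j = cellNonempty⇒nonzero ∘ cycle-cellsNonempty i j

    lastPoint-cyclePoint : ∀ {x} → LastPoints π cycle x → CyclePoint x
    lastPoint-cyclePoint (ic , x-last) with w , same-col , same-row , w-on ← cell-cyclePoint ic =
      subst CyclePoint (isLast-unique (cyclePoint-isLast w-on) x-last same-col same-row) w-on

    cycle-indivisible : Indivisible π (LastPoints π cycle)
    cycle-indivisible (s , (x , Ax , sx) , (y , Ay , sy) , precedes) =
      contradiction (trans (sym sx) (cyclePoint-false (lastPoint-cyclePoint Ax))) λ ()
      where
      v-false : ∀ {t} → s (u t) ≡ false → s (v t) ≡ false
      v-false {t} = split-false-closed precedes (v∈lastPoints t) (u∈lastPoints t)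
        (lastOnRow-notPrecedes (v-rowLast t) (sym (row-v t)))

      next-false : ∀ {t t′} → u t′ ≡ next (u t) → s (v t) ≡ false → s (u t′) ≡ false
      next-false {t} u≡ = split-false-closed precedes (u∈lastPoints _) (v∈lastPoints t)
        (subst (λ z → ¬ Precedes π z (v t)) (sym u≡)
          (lastOnColumn-notPrecedes (Columns.lastOnLine-isLast (v t))
            (sym (Columns.line-lastOnLine (v t)))))

      some-false : ∀ {z} → CyclePoint z → s z ≡ false → ∃ λ t → s (u t) ≡ false
      some-false (u-point t)  sz = t , sz
      some-false (v-point u≡) sz = _ , next-false u≡ sz

      all-false : ∀ t → s (u t) ≡ false
      all-false = cyclic-induction (λ t → s (u t) ≡ false)
        (λ j → next-false (point-suc j) ∘ v-false) (next-false point-zero ∘ v-false)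
        (proj₂ (some-false (lastPoint-cyclePoint Ay) sy))

      cyclePoint-false : ∀ {z} → CyclePoint z → s z ≡ false
      cyclePoint-false (u-point t) = all-false t
      cyclePoint-false (v-point _) = v-false (all-false _)

lemma3p7 : {m n : ℕ} (P : PMM m n) (π : GPerm P) →
    2 ≤ size π → MIndivisible π →
    Σ (Cycle P) λ C → IsCycleOf C
      × (∀ i j → InCycle C i j → CellNonempty π i j)
      × Indivisible π (LastPoints π C)
lemma3p7 P π two indivisible with cyclicOrbit (next π) (fromℕ< two)
... | zero  , O =
  contradiction (fixedPoint⇒divisible π (sym (CyclicOrbit.point-zero O)) two) indivisible
... | suc _ , O = cycle , cycle-isCycleOf , cycle-cellsNonempty , cycle-indivisible
  where open OrbitCycle π O
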